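{- Let $q$ and $s$ be indeterminates and consider linear operators on the space of polynomials in $x$. Let $X$ be multiplication by $x$ and $D_q$ the $q$-differentiation operator $D_qf(x)=\frac{f(qx)-f(x)}{(q-1)x}$. Then for every $n\ge0$, $$(X+q^{n-1}sD_q)(X+q^{n-2}sD_q)\cdots(X+sD_q)=\sum_{m=0}^n\sum_{j=0}^{\min(m,n-m)} q^{\binom{j+1}{2}+\binom{n-m}{2}}\,(1+q^{m+1})(1+q^{m+2})\cdots(1+q^{n-j})\,\frac{[n]!\,s^{n-m}}{(1+q)(1+q^2)\cdots(1+q^{n-m})\,[j]!\,[m-j]!\,[n-m-j]!}\,X^{m-j}D_q^{n-m-j}.$$
   Context: Notation: $[n]=1+q+\cdots+q^{n-1}$, $[n]!=[1][2]\cdots[n]$ with $[0]!=1$. Empty products (e.g. $(1+q^{m+1})\cdots(1+q^{n-j})$ when $n-j<m+1$, or $(1+q)\cdots(1+q^{n-m})$ when $n=m$) equal $1$. $X^aD_q^b$ denotes the composition of $b$ applications of $D_q$ followed by multiplication by $x^a$. -}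

module Defs where

open import Level using (Level; _⊔_) renaming (suc to lsuc)
open import Data.Nat as ℕ using (ℕ; zero; suc; _∸_; _⊓_)
open import Data.Nat.Combinatorics using (_C_)
open import Data.Product using (∃; _×_)
open import Relation.Nullary using (¬_)
open import Algebra.Bundles using (CommutativeRing)

record Field (c ℓ : Level) : Set (lsuc (c ⊔ ℓ)) where
  field
    commRing : CommutativeRing c ℓ
  open CommutativeRing commRing public
  field
    _⁻¹     : Carrier → Carrier
    0≉1     : ¬ (0# ≈ 1#)
    inverse : ∀ x → ¬ (x ≈ 0#) → x * (x ⁻¹) ≈ 1#

module Ops {c ℓ : Level} (F : Field c ℓ) where
  open Field F

  infixr 8 _^_
  _^_ : Carrier → ℕ → Carrier
  x ^ zero  = 1#
  x ^ suc n = x * (x ^ n)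

  Σ< : ℕ → (ℕ → Carrier) → Carrier
  Σ< zero    f = 0#
  Σ< (suc n) f = Σ< n f + f n

  Π< : ℕ → (ℕ → Carrier) → Carrier
  Π< zero    f = 1#
  Π< (suc n) f = Π< n f * f n

  -- product_{i=a}^{b} f i  (empty, i.e. 1, when b < a)
  Π[_,_] : ℕ → ℕ → (ℕ → Carrier) → Carrier
  Π[ a , b ] f = Π< (suc b ∸ a) (λ i → f (a ℕ.+ i))

  qint : Carrier → ℕ → Carrier
  qint q n = Σ< n (λ i → q ^ i)

  qfact : Carrier → ℕ → Carrier
  qfact q n = Π[ 1 , n ] (qint q)

  -- Polynomials in x over the field, as coefficient sequences
  -- (finite support is imposed where they are quantified).
  Poly : Set c
  Poly = ℕ → Carrier

  FiniteSupport : Poly → Set ℓ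
  FiniteSupport f = ∃ λ N → ∀ k → N ℕ.≤ k → f k ≈ 0#

  Op : Set c
  Op = Poly → Poly

  X : Op
  X f zero    = 0#
  X f (suc k) = f k

  -- D_q f(x) = (f(qx) - f(x)) / ((q-1) x), computed coefficientwise:
  -- f(qx) - f(x) has coefficients (q^k - 1) f_k (constant term 0);
  -- dividing by x shifts, dividing by (q-1) multiplies by (q-1)⁻¹.
  Dq : Carrier → Op
  Dq q f k = ((q ^ suc k - 1#) * f (suc k)) * ((q - 1#) ⁻¹)

  _⊕_ : Op → Op → Op
  (A ⊕ B) f k = A f k + B f k

  _·_ : Carrier → Op → Op
  (a · A) f k = a * A f k

  iter : ℕ → Op → Op
  iter zero    A f = f
  iter (suc n) A f = A (iter n A f)

  XD : Carrier → ℕ → ℕ → Op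
  XD q a b f = iter a X (iter b (Dq q) f)

  lhs : Carrier → Carrier → ℕ → Op
  lhs q s zero    f = f
  lhs q s (suc n) f = (X ⊕ ((q ^ n * s) · Dq q)) (lhs q s n f)

  coeff : Carrier → Carrier → ℕ → ℕ → ℕ → Carrier
  coeff q s n m j =
    q ^ ((suc j C 2) ℕ.+ ((n ∸ m) C 2))
    * Π[ suc m , n ∸ j ] (λ i → 1# + q ^ i)
    * (qfact q n * s ^ (n ∸ m))
    * ((Π[ 1 , n ∸ m ] (λ i → 1# + q ^ i)
         * qfact q j * qfact q (m ∸ j) * qfact q (n ∸ m ∸ j)) ⁻¹)

  rhs : Carrier → Carrier → ℕ → Op
  rhs q s n f k =
    Σ< (suc n) (λ m →
      Σ< (suc (m ⊓ (n ∸ m))) (λ j →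
        coeff q s n m j * XD q (m ∸ j) (n ∸ m ∸ j) f k))

-- Reindex the term (m, j) of the right-hand side by b = m - j, c = n - m - j, so that
-- it is K(j, b, c) X^b D_q^c with n = b + 2j + c.
-- By the q-commutation rule D_q X^a = q^a X^a D_q + [a] X^{a-1}, the factor
-- X + t D_q sends X^b D_q^c to X^{b+1} D_q^c + t q^b X^b D_q^{c+1} + t [b] X^{b-1} D_q^c,
-- so the normal form of the (n+1)-st product arises from that of the n-th by an
-- explicit linear step on coefficient arrays (NF-step, for arbitrary arrays).  It
-- remains to check that the closed form satisfies the resulting recurrence
--   K(j,b,c) = K(j,b-1,c) + q^n s q^b K(j,b,c-1) + q^n s [b+1] K(j-1,b+1,c)
-- (K-recurrence); after clearing denominators this is a polynomial identity in
-- q^j, q^b, q^c, [j], [b], [c] (recurrence-identity), proved by linearity in the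
-- q-integers.
module Submission where

open import Defs
open import Level using (Level)
open import Data.Nat using (ℕ; suc)
open import Relation.Nullary using (¬_)

open import Data.Nat as ℕ using (zero; _∸_; _⊓_; _≤_; _<_; s≤s; _≤?_)
open import Data.Nat.Combinatorics using (_C_; nCk+nC[k+1]≡[n+1]C[k+1]; nC1≡n)
open import Data.Nat.Tactic.RingSolver using (solve-∀)
import Data.Nat.Properties as ℕₚ
open import Data.Product using (_×_; _,_)
open import Data.Empty using (⊥-elim)
open import Relation.Nullary using (Dec; yes; no)
open import Relation.Nullary.Decidable using (_×-dec_)
import Relation.Binary.PropositionalEquality as P
open P using (_≡_)

-- (m, j) indexes a term X^{m-j} D_q^{n-m-j} of the n-th normal form
-- exactly when j ≤ m and m + j ≤ n.
InRange : ℕ → ℕ → ℕ → Set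
InRange n m j = j ≤ m × m ℕ.+ j ≤ n

inRange? : ∀ n m j → Dec (InRange n m j)
inRange? n m j = (j ≤? m) ×-dec (m ℕ.+ j ≤? n)

inRange-raise : ∀ {n m j} → InRange n m j → InRange (suc n) (suc m) j
inRange-raise (j≤m , m+j≤n) = ℕₚ.m≤n⇒m≤1+n j≤m , s≤s m+j≤n

inRange-suc : ∀ {n m j} → InRange n m j → InRange (suc n) m j
inRange-suc (j≤m , m+j≤n) = j≤m , ℕₚ.m≤n⇒m≤1+n m+j≤n

¬inRange-row : ∀ n j → ¬ InRange n (suc n) j
¬inRange-row n j (_ , h) = ℕₚ.1+n≰n (ℕₚ.≤-trans (s≤s (ℕₚ.m≤m+n n j)) h)

¬inRange-col : ∀ n m → ¬ InRange n m (suc n)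
¬inRange-col n m (_ , h) = ℕₚ.1+n≰n (ℕₚ.≤-trans (ℕₚ.m≤n+m (suc n) m) h)

∸-suc-out : ∀ {m j} → j ≤ m → suc m ∸ j ≡ suc (m ∸ j)
∸-suc-out j≤m = ℕₚ.+-∸-assoc 1 j≤m

∸-pred-in : ∀ m j → m ∸ j ∸ 1 ≡ m ∸ suc j
∸-pred-in m j = P.trans (ℕₚ.∸-+-assoc m j 1) (P.cong (m ∸_) (ℕₚ.+-comm j 1))

∸∸-suc-out : ∀ {n} m j → m ℕ.+ j ≤ n → suc n ∸ m ∸ j ≡ suc (n ∸ m ∸ j)
∸∸-suc-out {n} m j m+j≤n =
  P.trans (P.cong (_∸ j) (ℕₚ.+-∸-assoc 1 (ℕₚ.m+n≤o⇒m≤o m m+j≤n)))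
          (ℕₚ.+-∸-assoc 1 (ℕₚ.m+n≤o⇒m≤o∸n j (P.subst (_≤ n) (ℕₚ.+-comm m j) m+j≤n)))

∸∸-suc-both : ∀ {n} m j → m ℕ.+ j ≤ n → suc n ∸ m ∸ suc j ≡ n ∸ m ∸ j
∸∸-suc-both m j m+j≤n = P.cong (_∸ suc j) (ℕₚ.+-∸-assoc 1 (ℕₚ.m+n≤o⇒m≤o m m+j≤n))

C₂-suc : ∀ k → suc k C 2 ≡ k ℕ.+ k C 2
C₂-suc k = P.trans (P.sym (nCk+nC[k+1]≡[n+1]C[k+1] k 1)) (P.cong (ℕ._+ k C 2) (nC1≡n k))

-- The exponent C(j+1, 2) + C(j+c, 2) of q in the coefficient of X^b D_q^c.
qexp : ℕ → ℕ → ℕ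
qexp j c = suc j C 2 ℕ.+ (j ℕ.+ c) C 2

-- Exponent bookkeeping for the diagonal contribution to K(j, b, c + 1):
-- with n = b + 2j + c, q^n q^{qexp j c} = q^{qexp j (c+1)} q^j q^b ...
qexp-sucᶜ : ∀ b j c → (b ℕ.+ j ℕ.+ (j ℕ.+ c)) ℕ.+ qexp j c ≡ qexp j (suc c) ℕ.+ j ℕ.+ b
qexp-sucᶜ b j c = P.trans (reorder b j c (suc j C 2) ((j ℕ.+ c) C 2))
  (P.cong (λ u → suc j C 2 ℕ.+ u ℕ.+ j ℕ.+ b)
    (P.trans (P.sym (C₂-suc (j ℕ.+ c))) (P.cong (_C 2) (P.sym (ℕₚ.+-suc j c)))))
  where
    reorder : ∀ b j c X Y → (b ℕ.+ j ℕ.+ (j ℕ.+ c)) ℕ.+ (X ℕ.+ Y) ≡ X ℕ.+ ((j ℕ.+ c) ℕ.+ Y) ℕ.+ j ℕ.+ b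
    reorder = solve-∀

-- ... and for the lowering contribution to K(j + 1, b, c):
-- with n = b + 1 + 2j + c, q^n q^{qexp j c} = q^{qexp (j+1) c} q^b.
qexp-sucʲ : ∀ b j c → (suc b ℕ.+ j ℕ.+ (j ℕ.+ c)) ℕ.+ qexp j c ≡ qexp (suc j) c ℕ.+ b
qexp-sucʲ b j c = P.trans (reorder b j c (suc j C 2) ((j ℕ.+ c) C 2))
  (P.cong (ℕ._+ b) (P.sym (P.cong₂ ℕ._+_ (C₂-suc (suc j)) (C₂-suc (j ℕ.+ c)))))
  where
    reorder : ∀ b j c X Y → (suc b ℕ.+ j ℕ.+ (j ℕ.+ c)) ℕ.+ (X ℕ.+ Y) ≡ (suc j ℕ.+ X) ℕ.+ ((j ℕ.+ c) ℕ.+ Y) ℕ.+ b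
    reorder = solve-∀

module _ {c₀ ℓ : Level} (F : Field c₀ ℓ) where
  open Field F hiding (zero)
  open Ops F
  open import Algebra.Solver.Ring.NaturalCoefficients.Default commutativeSemiring
  open import Algebra.Properties.Group +-group using (∙-cancelʳ)
  open import Relation.Binary.Reasoning.Setoid setoid

  *-nonzero : ∀ {a b} → ¬ a ≈ 0# → ¬ b ≈ 0# → ¬ (a * b) ≈ 0#
  *-nonzero {a} {b} a≉0 b≉0 ab≈0 = a≉0 (begin
    a                ≈⟨ *-identityʳ a ⟨
    a * 1#           ≈⟨ *-congˡ (inverse b b≉0) ⟨
    a * (b * b ⁻¹)   ≈⟨ *-assoc a b (b ⁻¹) ⟨
    (a * b) * b ⁻¹   ≈⟨ *-congʳ ab≈0 ⟩
    0# * b ⁻¹        ≈⟨ zeroˡ _ ⟩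
    0# ∎)

  ⁻¹-cancelʳ : ∀ {d} x → ¬ d ≈ 0# → (x * d ⁻¹) * d ≈ x
  ⁻¹-cancelʳ {d} x d≉0 = begin
    (x * d ⁻¹) * d   ≈⟨ *-assoc x (d ⁻¹) d ⟩
    x * (d ⁻¹ * d)   ≈⟨ *-congˡ (*-comm (d ⁻¹) d) ⟩
    x * (d * d ⁻¹)   ≈⟨ *-congˡ (inverse d d≉0) ⟩
    x * 1#           ≈⟨ *-identityʳ x ⟩
    x ∎

  *-⁻¹-cancel : ∀ {d} x → ¬ d ≈ 0# → (x * d) * d ⁻¹ ≈ x
  *-⁻¹-cancel {d} x d≉0 = begin
    (x * d) * d ⁻¹   ≈⟨ *-assoc x d (d ⁻¹) ⟩
    x * (d * d ⁻¹)   ≈⟨ *-congˡ (inverse d d≉0) ⟩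
    x * 1#           ≈⟨ *-identityʳ x ⟩
    x ∎

  *-cancelʳ : ∀ {d x y} → ¬ d ≈ 0# → x * d ≈ y * d → x ≈ y
  *-cancelʳ {d} {x} {y} d≉0 e = begin
    x               ≈⟨ *-⁻¹-cancel x d≉0 ⟨
    (x * d) * d ⁻¹  ≈⟨ *-congʳ e ⟩
    (y * d) * d ⁻¹  ≈⟨ *-⁻¹-cancel y d≉0 ⟩
    y ∎

  *-cancelˡ : ∀ {d x y} → ¬ d ≈ 0# → d * x ≈ d * y → x ≈ y
  *-cancelˡ {d} {x} {y} d≉0 e = *-cancelʳ d≉0 (trans (*-comm x d) (trans e (*-comm d y)))

  ^-+ : ∀ x a b → x ^ (a ℕ.+ b) ≈ x ^ a * x ^ b
  ^-+ x zero b = sym (*-identityˡ _)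
  ^-+ x (suc a) b = begin
    x * x ^ (a ℕ.+ b)     ≈⟨ *-congˡ (^-+ x a b) ⟩
    x * (x ^ a * x ^ b)   ≈⟨ *-assoc x _ _ ⟨
    x * x ^ a * x ^ b ∎

  ^-+₃ : ∀ x a b d → x ^ (a ℕ.+ b ℕ.+ d) ≈ x ^ a * x ^ b * x ^ d
  ^-+₃ x a b d = trans (^-+ x (a ℕ.+ b) d) (*-congʳ (^-+ x a b))

  Σ-cong : ∀ a {g h : ℕ → Carrier} → (∀ i → g i ≈ h i) → Σ< a g ≈ Σ< a h
  Σ-cong zero e = refl
  Σ-cong (suc a) e = +-cong (Σ-cong a e) (e a)

  Σ-cong< : ∀ a {g h : ℕ → Carrier} → (∀ i → i < a → g i ≈ h i) → Σ< a g ≈ Σ< a h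
  Σ-cong< zero e = refl
  Σ-cong< (suc a) e = +-cong (Σ-cong< a (λ i i<a → e i (ℕₚ.m≤n⇒m≤1+n i<a))) (e a ℕₚ.≤-refl)

  Σ-+ : ∀ a (g h : ℕ → Carrier) → Σ< a (λ i → g i + h i) ≈ Σ< a g + Σ< a h
  Σ-+ zero g h = sym (+-identityʳ 0#)
  Σ-+ (suc a) g h = begin
    Σ< a (λ i → g i + h i) + (g a + h a) ≈⟨ +-congʳ (Σ-+ a g h) ⟩
    (Σ< a g + Σ< a h) + (g a + h a)      ≈⟨ solve 4 (λ u v w z → (u :+ v) :+ (w :+ z) := (u :+ w) :+ (v :+ z)) refl (Σ< a g) (Σ< a h) (g a) (h a) ⟩
    (Σ< a g + g a) + (Σ< a h + h a) ∎

  Σ-*ˡ : ∀ a d (g : ℕ → Carrier) → d * Σ< a g ≈ Σ< a (λ i → d * g i)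
  Σ-*ˡ zero d g = zeroʳ d
  Σ-*ˡ (suc a) d g = trans (distribˡ d _ _) (+-congʳ (Σ-*ˡ a d g))

  Σ-dropLast : ∀ a (g : ℕ → Carrier) → g a ≈ 0# → Σ< (suc a) g ≈ Σ< a g
  Σ-dropLast a g e = trans (+-congˡ e) (+-identityʳ _)

  Σ-dropFirst : ∀ a (g : ℕ → Carrier) → g 0 ≈ 0# → Σ< (suc a) g ≈ Σ< a (λ i → g (suc i))
  Σ-dropFirst zero g e = trans (+-identityˡ _) e
  Σ-dropFirst (suc a) g e = +-congʳ (Σ-dropFirst a g e)

  Σ-pad : ∀ {a b} (g : ℕ → Carrier) → a ≤ b → (∀ i → a ≤ i → g i ≈ 0#) → Σ< b g ≈ Σ< a g
  Σ-pad {a} {b} g a≤b e with ℕₚ.m≤n⇒∃[o]m+o≡n a≤b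
  ... | t , P.refl = go t
    where
      go : ∀ t → Σ< (a ℕ.+ t) g ≈ Σ< a g
      go zero = reflexive (P.cong (λ u → Σ< u g) (ℕₚ.+-identityʳ a))
      go (suc t) = begin
        Σ< (a ℕ.+ suc t) g             ≡⟨ P.cong (λ u → Σ< u g) (ℕₚ.+-suc a t) ⟩
        Σ< (a ℕ.+ t) g + g (a ℕ.+ t)  ≈⟨ +-cong (go t) (e (a ℕ.+ t) (ℕₚ.m≤m+n a t)) ⟩
        Σ< a g + 0#                   ≈⟨ +-identityʳ _ ⟩
        Σ< a g ∎

  Σ-zero : ∀ a (g : ℕ → Carrier) → (∀ i → g i ≈ 0#) → Σ< a g ≈ 0#
  Σ-zero zero g e = refl
  Σ-zero (suc a) g e = trans (+-cong (Σ-zero a g e) (e a)) (+-identityʳ 0#)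

  Σ² : ℕ → ℕ → (ℕ → ℕ → Carrier) → Carrier
  Σ² M N g = Σ< M (λ m → Σ< N (g m))

  Σ²-cong : ∀ M N {g h : ℕ → ℕ → Carrier} → (∀ m j → g m j ≈ h m j) → Σ² M N g ≈ Σ² M N h
  Σ²-cong M N e = Σ-cong M (λ m → Σ-cong N (e m))

  Σ²-+ : ∀ M N (g h : ℕ → ℕ → Carrier) → Σ² M N (λ m j → g m j + h m j) ≈ Σ² M N g + Σ² M N h
  Σ²-+ M N g h = trans (Σ-cong M (λ m → Σ-+ N (g m) (h m))) (Σ-+ M _ _)

  Σ²-*ˡ : ∀ M N d (g : ℕ → ℕ → Carrier) → d * Σ² M N g ≈ Σ² M N (λ m j → d * g m j)
  Σ²-*ˡ M N d g = trans (Σ-*ˡ M d _) (Σ-cong M (λ m → Σ-*ˡ N d (g m)))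

  Σ²-dropLastRow : ∀ M N (g : ℕ → ℕ → Carrier) → (∀ j → g M j ≈ 0#) → Σ² (suc M) N g ≈ Σ² M N g
  Σ²-dropLastRow M N g e = Σ-dropLast M _ (Σ-zero N (g M) e)

  Σ²-dropLastCol : ∀ M N (g : ℕ → ℕ → Carrier) → (∀ m → g m N ≈ 0#) → Σ² M (suc N) g ≈ Σ² M N g
  Σ²-dropLastCol M N g e = Σ-cong M (λ m → Σ-dropLast N (g m) (e m))

  Σ²-dropFirstRow : ∀ M N (g : ℕ → ℕ → Carrier) → (∀ j → g 0 j ≈ 0#) →
                    Σ² (suc M) N g ≈ Σ² M N (λ m → g (suc m))
  Σ²-dropFirstRow M N g e = Σ-dropFirst M _ (Σ-zero N (g 0) e)

  Σ²-dropFirstCol : ∀ M N (g : ℕ → ℕ → Carrier) → (∀ m → g m 0 ≈ 0#) →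
                    Σ² M (suc N) g ≈ Σ² M N (λ m j → g m (suc j))
  Σ²-dropFirstCol M N g e = Σ-cong M (λ m → Σ-dropFirst N (g m) (e m))

  when : ∀ {a} {A : Set a} → Dec A → Carrier → Carrier
  when (yes _) v = v
  when (no _)  _ = 0#

  when-yes : ∀ {a} {A : Set a} (d : Dec A) → A → ∀ v → when d v ≈ v
  when-yes (yes _) _ v = refl
  when-yes (no ¬a) a v = ⊥-elim (¬a a)

  when-no : ∀ {a} {A : Set a} (d : Dec A) → ¬ A → ∀ v → when d v ≈ 0#
  when-no (yes a) ¬a v = ⊥-elim (¬a a)
  when-no (no _)  _  v = refl

  -- Coefficient arrays (m, j) ↦ a(m, j) of normal forms, and their support.
  Coeffs : Set c₀
  Coeffs = ℕ → ℕ → Carrier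

  Supported : ℕ → Coeffs → Set ℓ
  Supported n a = ∀ m j → ¬ InRange n m j → a m j ≈ 0#

  *-vanishˡ : ∀ {a} b → a ≈ 0# → a * b ≈ 0#
  *-vanishˡ b e = trans (*-congʳ e) (zeroˡ b)

  *-vanishʳ : ∀ a {b} → b ≈ 0# → a * b ≈ 0#
  *-vanishʳ a e = trans (*-congˡ e) (zeroʳ a)

  _≐_ : Poly → Poly → Set ℓ
  g ≐ h = ∀ k → g k ≈ h k

  X-cong : ∀ {g h} → g ≐ h → X g ≐ X h
  X-cong e zero = refl
  X-cong e (suc k) = e k

  X-lin : ∀ u v g h → X (λ k → u * g k + v * h k) ≐ (λ k → u * X g k + v * X h k)
  X-lin u v g h zero = sym (trans (+-cong (zeroʳ u) (zeroʳ v)) (+-identityʳ 0#))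
  X-lin u v g h (suc k) = refl

  X-Σ² : ∀ M N (a : ℕ → ℕ → Carrier) (G : ℕ → ℕ → Poly) →
         X (λ k → Σ² M N (λ m j → a m j * G m j k)) ≐ (λ k → Σ² M N (λ m j → a m j * X (G m j) k))
  X-Σ² M N a G zero = sym (Σ-zero M _ (λ m → Σ-zero N _ (λ j → zeroʳ (a m j))))
  X-Σ² M N a G (suc k) = refl

  module QCalculus (q : Carrier) where

    qint-suc : ∀ a → 1# + q * qint q a ≈ qint q (suc a)
    qint-suc zero = begin
      1# + q * 0#   ≈⟨ +-congˡ (zeroʳ q) ⟩
      1# + 0#       ≈⟨ +-comm _ _ ⟩
      0# + 1# ∎
    qint-suc (suc a) = begin
      1# + q * (qint q a + q ^ a)        ≈⟨ solve 3 (λ Q I w → con 1 :+ Q :* (I :+ w) := (con 1 :+ Q :* I) :+ Q :* w) refl q (qint q a) (q ^ a) ⟩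
      (1# + q * qint q a) + q * q ^ a    ≈⟨ +-congʳ (qint-suc a) ⟩
      qint q (suc a) + q ^ suc a ∎

    qint-+ : ∀ a b → qint q (a ℕ.+ b) ≈ qint q a + q ^ a * qint q b
    qint-+ a zero = begin
      qint q (a ℕ.+ 0)      ≡⟨ P.cong (qint q) (ℕₚ.+-identityʳ a) ⟩
      qint q a              ≈⟨ +-identityʳ _ ⟨
      qint q a + 0#         ≈⟨ +-congˡ (zeroʳ _) ⟨
      qint q a + q ^ a * 0# ∎
    qint-+ a (suc b) = begin
      qint q (a ℕ.+ suc b)                           ≡⟨ P.cong (qint q) (ℕₚ.+-suc a b) ⟩
      qint q (a ℕ.+ b) + q ^ (a ℕ.+ b)               ≈⟨ +-cong (qint-+ a b) (^-+ q a b) ⟩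
      (qint q a + q ^ a * qint q b) + q ^ a * q ^ b  ≈⟨ solve 4 (λ A x B y → (A :+ x :* B) :+ x :* y := A :+ x :* (B :+ y)) refl (qint q a) (q ^ a) (qint q b) (q ^ b) ⟩
      qint q a + q ^ a * (qint q b + q ^ b) ∎

    qint-sub : ∀ a → qint q a * (q - 1#) ≈ q ^ a - 1#
    qint-sub a = begin
      I * (q + m)                  ≈⟨ +-identityʳ _ ⟨
      I * (q + m) + 0#             ≈⟨ +-congˡ (-‿inverseʳ 1#) ⟨
      I * (q + m) + (1# + m)       ≈⟨ solve 3 (λ I Q m → I :* (Q :+ m) :+ (con 1 :+ m) := (con 1 :+ Q :* I) :+ (I :* m :+ m)) refl I q m ⟩
      (1# + q * I) + (I * m + m)   ≈⟨ +-congʳ (qint-suc a) ⟩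
      (I + q ^ a) + (I * m + m)    ≈⟨ solve 3 (λ I w m → (I :+ w) :+ (I :* m :+ m) := (w :+ m) :+ I :* (con 1 :+ m)) refl I (q ^ a) m ⟩
      (q ^ a + m) + I * (1# + m)   ≈⟨ +-congˡ (*-vanishʳ I (-‿inverseʳ 1#)) ⟩
      (q ^ a + m) + 0#             ≈⟨ +-identityʳ _ ⟩
      q ^ a + m ∎
      where
        I = qint q a
        m = - 1#

    -- The coefficients of (X + t D_q) applied to a normal form with coefficients a:
    -- the term (m, j) of a produces, by the q-commutation rule, the terms
    -- (m + 1, j) with factor 1, (m, j) with factor t q^{m-j} and (m, j + 1)
    -- with factor t [m - j].
    raise : Coeffs → Coeffs
    raise a zero    j = 0#
    raise a (suc m) j = a m j

    lower : Coeffs → Coeffs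
    lower a m zero    = 0#
    lower a m (suc j) = qint q (m ∸ j) * a m j

    next : Carrier → Coeffs → Coeffs
    next t a m j = raise a m j + (t * (q ^ (m ∸ j) * a m j) + t * lower a m j)

    next-supported : ∀ n t a → Supported n a → Supported (suc n) (next t a)
    next-supported n t a sup m j out = begin
      raise a m j + (t * (q ^ (m ∸ j) * a m j) + t * lower a m j)  ≈⟨ +-cong (raise-0 m out) (+-cong (*-vanishʳ t (*-vanishʳ _ a-0)) (*-vanishʳ t (lower-0 j out))) ⟩
      0# + (0# + 0#)                                               ≈⟨ trans (+-identityˡ _) (+-identityˡ _) ⟩
      0# ∎
      where
        a-0 : a m j ≈ 0#
        a-0 = sup m j (λ r → out (inRange-suc r))
        raise-0 : ∀ m → ¬ InRange (suc n) m j → raise a m j ≈ 0#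
        raise-0 zero    _   = refl
        raise-0 (suc m) out = sup m j (λ r → out (inRange-raise r))
        -- (m, j) in range at level n but (m, j + 1) not at level n + 1 forces m = j.
        lower-0 : ∀ j → ¬ InRange (suc n) m j → lower a m j ≈ 0#
        lower-0 zero _ = refl
        lower-0 (suc j) out with inRange? n m j
        ... | no  r = *-vanishʳ _ (sup m j r)
        ... | yes (j≤m , m+j≤n) = *-vanishˡ (a m j) (reflexive (P.cong (qint q) m∸j≡0))
          where
            j+1≰m : ¬ suc j ≤ m
            j+1≰m sj≤m = out (sj≤m , P.subst (_≤ suc n) (P.sym (ℕₚ.+-suc m j)) (s≤s m+j≤n))
            m∸j≡0 : m ∸ j ≡ 0
            m∸j≡0 = P.trans (P.cong (_∸ j) (ℕₚ.≤-antisym (ℕₚ.≮⇒≥ j+1≰m) j≤m)) (ℕₚ.n∸n≡0 j)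

    module Derivative (q≉1 : ¬ q ≈ 1#) where

      q-1≉0 : ¬ (q - 1#) ≈ 0#
      q-1≉0 e = q≉1 (begin
        q                   ≈⟨ +-identityʳ q ⟨
        q + 0#              ≈⟨ +-congˡ (-‿inverseˡ 1#) ⟨
        q + (- 1# + 1#)     ≈⟨ +-assoc q _ _ ⟨
        (q - 1#) + 1#       ≈⟨ +-congʳ e ⟩
        0# + 1#             ≈⟨ +-identityˡ 1# ⟩
        1# ∎)

      Dq-coeff : ∀ g k → Dq q g k ≈ qint q (suc k) * g (suc k)
      Dq-coeff g k = begin
        ((q ^ suc k - 1#) * g (suc k)) * w ⁻¹  ≈⟨ *-congʳ (*-congʳ (qint-sub (suc k))) ⟨
        ((I * w) * g (suc k)) * w ⁻¹           ≈⟨ *-congʳ (solve 3 (λ I w G → (I :* w) :* G := (I :* G) :* w) refl I w (g (suc k))) ⟩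
        ((I * g (suc k)) * w) * w ⁻¹           ≈⟨ *-⁻¹-cancel (I * g (suc k)) q-1≉0 ⟩
        I * g (suc k) ∎
        where
          I = qint q (suc k)
          w = q - 1#

      Dq-cong : ∀ {g h} → g ≐ h → Dq q g ≐ Dq q h
      Dq-cong {g} {h} e k = trans (Dq-coeff g k) (trans (*-congˡ (e (suc k))) (sym (Dq-coeff h k)))

      Dq-Σ² : ∀ M N (a : ℕ → ℕ → Carrier) (G : ℕ → ℕ → Poly) →
              Dq q (λ k → Σ² M N (λ m j → a m j * G m j k)) ≐ (λ k → Σ² M N (λ m j → a m j * Dq q (G m j) k))
      Dq-Σ² M N a G k = begin
        Dq q (λ k → Σ² M N (λ m j → a m j * G m j k)) k               ≈⟨ Dq-coeff (λ k → Σ² M N (λ m j → a m j * G m j k)) k ⟩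
        I * Σ² M N (λ m j → a m j * G m j (suc k))                   ≈⟨ Σ²-*ˡ M N I _ ⟩
        Σ² M N (λ m j → I * (a m j * G m j (suc k)))                 ≈⟨ Σ²-cong M N (λ m j → solve 3 (λ I a G → I :* (a :* G) := a :* (I :* G)) refl I (a m j) (G m j (suc k))) ⟩
        Σ² M N (λ m j → a m j * (I * G m j (suc k)))                 ≈⟨ Σ²-cong M N (λ m j → *-congˡ (Dq-coeff (G m j) k)) ⟨
        Σ² M N (λ m j → a m j * Dq q (G m j) k) ∎
        where I = qint q (suc k)

      Dq-X : ∀ g → Dq q (X g) ≐ (λ k → q * X (Dq q g) k + g k)
      Dq-X g zero = begin
        Dq q (X g) 0      ≈⟨ Dq-coeff (X g) 0 ⟩
        (0# + 1#) * g 0   ≈⟨ *-congʳ (+-identityˡ 1#) ⟩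
        1# * g 0          ≈⟨ *-identityˡ (g 0) ⟩
        g 0               ≈⟨ +-identityˡ (g 0) ⟨
        0# + g 0          ≈⟨ +-congʳ (zeroʳ q) ⟨
        q * 0# + g 0 ∎
      Dq-X g (suc k) = begin
        Dq q (X g) (suc k)                             ≈⟨ Dq-coeff (X g) (suc k) ⟩
        qint q (suc (suc k)) * g (suc k)               ≈⟨ *-congʳ (qint-suc (suc k)) ⟨
        (1# + q * qint q (suc k)) * g (suc k)          ≈⟨ solve 3 (λ Q I G → (con 1 :+ Q :* I) :* G := Q :* (I :* G) :+ G) refl q (qint q (suc k)) (g (suc k)) ⟩
        q * (qint q (suc k) * g (suc k)) + g (suc k)   ≈⟨ +-congʳ (*-congˡ (Dq-coeff g k)) ⟨
        q * Dq q g k + g (suc k) ∎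

      -- [a] X X^{a-1} = [a] X^a, both sides vanishing when a = 0.
      qint-X-pred : ∀ a g k → qint q a * X (iter (a ∸ 1) X g) k ≈ qint q a * iter a X g k
      qint-X-pred zero g k = trans (zeroˡ _) (sym (zeroˡ _))
      qint-X-pred (suc a) g k = refl

      Dq-Xⁿ : ∀ a g → Dq q (iter a X g) ≐ (λ k → q ^ a * iter a X (Dq q g) k + qint q a * iter (a ∸ 1) X g k)
      Dq-Xⁿ zero g k = begin
        Dq q g k                      ≈⟨ *-identityˡ _ ⟨
        1# * Dq q g k                 ≈⟨ +-identityʳ _ ⟨
        1# * Dq q g k + 0#            ≈⟨ +-congˡ (zeroˡ (g k)) ⟨
        1# * Dq q g k + 0# * g k ∎
      Dq-Xⁿ (suc a) g k = begin
        Dq q (X Xᵃg) k                                              ≈⟨ Dq-X Xᵃg k ⟩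
        q * X (Dq q Xᵃg) k + Xᵃg k                                  ≈⟨ +-congʳ (*-congˡ (X-cong (Dq-Xⁿ a g) k)) ⟩
        q * X (λ k → q ^ a * iter a X Dg k + I * iter (a ∸ 1) X g k) k + Xᵃg k
                                                                     ≈⟨ +-congʳ (*-congˡ (X-lin (q ^ a) I _ _ k)) ⟩
        q * (q ^ a * iter (suc a) X Dg k + I * X (iter (a ∸ 1) X g) k) + Xᵃg k
                                                                     ≈⟨ +-congʳ (*-congˡ (+-congˡ (qint-X-pred a g k))) ⟩
        q * (q ^ a * iter (suc a) X Dg k + I * Xᵃg k) + Xᵃg k       ≈⟨ solve 5 (λ Q w U I V → Q :* (w :* U :+ I :* V) :+ V := (Q :* w) :* U :+ (con 1 :+ Q :* I) :* V) refl q (q ^ a) (iter (suc a) X Dg k) I (Xᵃg k) ⟩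
        q ^ suc a * iter (suc a) X Dg k + (1# + q * I) * Xᵃg k     ≈⟨ +-congˡ (*-congʳ (qint-suc a)) ⟩
        q ^ suc a * iter (suc a) X Dg k + qint q (suc a) * Xᵃg k ∎
        where
          Xᵃg = iter a X g
          Dg = Dq q g
          I = qint q a

      q-cancel : ∀ L R → q * L + R ≈ q * R + L → L ≈ R
      q-cancel L R e = *-cancelˡ q-1≉0 (∙-cancelʳ (L + R) _ _ (begin
        (q - 1#) * L + (L + R)   ≈⟨ solve 3 (λ w L R → w :* L :+ (L :+ R) := (w :+ con 1) :* L :+ R) refl (q - 1#) L R ⟩
        ((q - 1#) + 1#) * L + R  ≈⟨ +-congʳ (*-congʳ q-1+1≈q) ⟩
        q * L + R                ≈⟨ e ⟩
        q * R + L                ≈⟨ +-congʳ (*-congʳ q-1+1≈q) ⟨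
        ((q - 1#) + 1#) * R + L  ≈⟨ solve 3 (λ w L R → (w :+ con 1) :* R :+ L := w :* R :+ (L :+ R)) refl (q - 1#) L R ⟩
        (q - 1#) * R + (L + R) ∎))
        where
          q-1+1≈q : (q - 1#) + 1# ≈ q
          q-1+1≈q = begin
            (q - 1#) + 1#    ≈⟨ +-assoc q (- 1#) 1# ⟩
            q + (- 1# + 1#)  ≈⟨ +-congˡ (-‿inverseˡ 1#) ⟩
            q + 0#           ≈⟨ +-identityʳ q ⟩
            q ∎

      -- The identity behind the coefficient recurrence.  With A = [j], B = [b],
      -- C′ = [c], x = q^j, y = q^b, z = q^c and [b+2j+c] = B + yA + yx(A + xC′) it reads
      --   [b+2j+c](1 + q^{b+j+c}) = [b](1 + q^{b+j}) + q^{j+2b}[c](1 + q^{j+c})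
      --                              + q^b [j](1 + q^{j+c})(1 + q^{b+j+c}).
      -- Both sides are linear in (A, B, C′), so it follows from the relations
      -- 1 + q[a] = [a] + q^a (which determine [a] as q ≠ 1) together with the
      -- polynomial identity LHS(x, y, z) - LHS(1, 1, 1) = RHS(x, y, z) - RHS(1, 1, 1),
      -- where LHS and RHS are the two sides as functions of (A, B, C′).
      recurrence-identity : ∀ A B C′ x y z → 1# + q * A ≈ A + x → 1# + q * B ≈ B + y → 1# + q * C′ ≈ C′ + z →
        (B + y * A + y * x * (A + x * C′)) * (1# + x * y * z) ≈
        B * (1# + x * y) + (x * y * y * C′ * (1# + x * z) + y * A * (1# + x * z) * (1# + x * y * z))
      recurrence-identity A B C′ x y z eA eB eC = q-cancel (LHS A B C′) (RHS A B C′) (∙-cancelʳ shift _ _ (begin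
        (q * LHS A B C′ + RHS A B C′) + shift                                   ≈⟨ expandˡ ⟩
        LHS (1# + q * A) (1# + q * B) (1# + q * C′) + (RHS A B C′ + RHS x y z)  ≈⟨ +-congʳ (LHS-cong eA eB eC) ⟩
        LHS (A + x) (B + y) (C′ + z) + (RHS A B C′ + RHS x y z)                  ≈⟨ linearity ⟩
        RHS (A + x) (B + y) (C′ + z) + (LHS A B C′ + LHS x y z)                  ≈⟨ +-congʳ (RHS-cong eA eB eC) ⟨
        RHS (1# + q * A) (1# + q * B) (1# + q * C′) + (LHS A B C′ + LHS x y z)  ≈⟨ expandʳ ⟩
        (q * RHS A B C′ + LHS A B C′) + shift ∎))
        where
          1ₑ : ∀ {k} → Polynomial k
          1ₑ = con 1
          LHSₑ RHSₑ : ∀ {k} → (x y z a b c : Polynomial k) → Polynomial k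
          LHSₑ x y z a b c = (b :+ y :* a :+ y :* x :* (a :+ x :* c)) :* (1ₑ :+ x :* y :* z)
          RHSₑ x y z a b c = b :* (1ₑ :+ x :* y) :+ (x :* y :* y :* c :* (1ₑ :+ x :* z) :+ y :* a :* (1ₑ :+ x :* z) :* (1ₑ :+ x :* y :* z))
          LHS RHS : Carrier → Carrier → Carrier → Carrier
          LHS a b c = (b + y * a + y * x * (a + x * c)) * (1# + x * y * z)
          RHS a b c = b * (1# + x * y) + (x * y * y * c * (1# + x * z) + y * a * (1# + x * z) * (1# + x * y * z))
          shift : Carrier
          shift = LHS 1# 1# 1# + RHS x y z
          expandˡ : (q * LHS A B C′ + RHS A B C′) + shift ≈ LHS (1# + q * A) (1# + q * B) (1# + q * C′) + (RHS A B C′ + RHS x y z)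
          expandˡ = solve 7 (λ q A B C′ x y z →
            (q :* LHSₑ x y z A B C′ :+ RHSₑ x y z A B C′) :+ (LHSₑ x y z 1ₑ 1ₑ 1ₑ :+ RHSₑ x y z x y z)
            := LHSₑ x y z (1ₑ :+ q :* A) (1ₑ :+ q :* B) (1ₑ :+ q :* C′) :+ (RHSₑ x y z A B C′ :+ RHSₑ x y z x y z)) refl q A B C′ x y z
          linearity : LHS (A + x) (B + y) (C′ + z) + (RHS A B C′ + RHS x y z) ≈ RHS (A + x) (B + y) (C′ + z) + (LHS A B C′ + LHS x y z)
          linearity = solve 6 (λ A B C′ x y z →
            LHSₑ x y z (A :+ x) (B :+ y) (C′ :+ z) :+ (RHSₑ x y z A B C′ :+ RHSₑ x y z x y z)
            := RHSₑ x y z (A :+ x) (B :+ y) (C′ :+ z) :+ (LHSₑ x y z A B C′ :+ LHSₑ x y z x y z)) refl A B C′ x y z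
          expandʳ : RHS (1# + q * A) (1# + q * B) (1# + q * C′) + (LHS A B C′ + LHS x y z) ≈ (q * RHS A B C′ + LHS A B C′) + shift
          expandʳ = solve 7 (λ q A B C′ x y z →
            RHSₑ x y z (1ₑ :+ q :* A) (1ₑ :+ q :* B) (1ₑ :+ q :* C′) :+ (LHSₑ x y z A B C′ :+ LHSₑ x y z x y z)
            := (q :* RHSₑ x y z A B C′ :+ LHSₑ x y z A B C′) :+ (LHSₑ x y z 1ₑ 1ₑ 1ₑ :+ RHSₑ x y z x y z)) refl q A B C′ x y z
          LHS-cong : ∀ {a a′ b b′ c c′} → a ≈ a′ → b ≈ b′ → c ≈ c′ → LHS a b c ≈ LHS a′ b′ c′
          LHS-cong ea eb ec = *-congʳ (+-cong (+-cong eb (*-congˡ ea)) (*-congˡ (+-cong ea (*-congˡ ec))))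
          RHS-cong : ∀ {a a′ b b′ c c′} → a ≈ a′ → b ≈ b′ → c ≈ c′ → RHS a b c ≈ RHS a′ b′ c′
          RHS-cong ea eb ec = +-cong (*-congʳ eb) (+-cong (*-congʳ (*-congˡ ec)) (*-congʳ (*-congʳ (*-congˡ ea))))

      module NormalForm (f : Poly) where

        monomial : ℕ → ℕ → ℕ → Poly
        monomial n m j = XD q (m ∸ j) (n ∸ m ∸ j) f

        NF : ℕ → Coeffs → Poly
        NF n a k = Σ² (suc n) (suc n) (λ m j → a m j * monomial n m j k)

        X-monomial : ∀ n a → Supported n a → ∀ k m j →
                     a m j * X (monomial n m j) k ≈ raise a (suc m) j * monomial (suc n) (suc m) j k
        X-monomial n a sup k m j with inRange? n m j
        ... | yes (j≤m , _) = reflexive (P.cong (λ i → a m j * XD q i (n ∸ m ∸ j) f k) (P.sym (∸-suc-out j≤m)))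
        ... | no out = trans (*-vanishˡ _ (sup m j out)) (sym (*-vanishˡ _ (sup m j out)))

        Dq-monomial : ∀ n t a → Supported n a → ∀ k m j →
                      t * (a m j * Dq q (monomial n m j) k) ≈
                      (t * (q ^ (m ∸ j) * a m j)) * monomial (suc n) m j k + (t * lower a m (suc j)) * monomial (suc n) m (suc j) k
        Dq-monomial n t a sup k m j with inRange? n m j
        ... | yes (_ , m+j≤n) = begin
          t * (a m j * Dq q (monomial n m j) k)                              ≈⟨ *-congˡ (*-congˡ (Dq-Xⁿ (m ∸ j) (iter (n ∸ m ∸ j) (Dq q) f) k)) ⟩
          t * (a m j * (q ^ (m ∸ j) * XD q (m ∸ j) (suc (n ∸ m ∸ j)) f k + qint q (m ∸ j) * XD q (m ∸ j ∸ 1) (n ∸ m ∸ j) f k))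
                                                                             ≈⟨ solve 6 (λ t a w U I V → t :* (a :* (w :* U :+ I :* V)) := (t :* (w :* a)) :* U :+ (t :* (I :* a)) :* V) refl t (a m j) (q ^ (m ∸ j)) _ (qint q (m ∸ j)) _ ⟩
          (t * (q ^ (m ∸ j) * a m j)) * XD q (m ∸ j) (suc (n ∸ m ∸ j)) f k + (t * lower a m (suc j)) * XD q (m ∸ j ∸ 1) (n ∸ m ∸ j) f k
                                                                             ≡⟨ P.cong₂ (λ b b′ → (t * (q ^ (m ∸ j) * a m j)) * XD q (m ∸ j) b f k + (t * lower a m (suc j)) * b′)
                                                                                  (P.sym (∸∸-suc-out m j m+j≤n)) (P.cong₂ (λ i i′ → XD q i i′ f k) (∸-pred-in m j) (P.sym (∸∸-suc-both m j m+j≤n))) ⟩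
          (t * (q ^ (m ∸ j) * a m j)) * monomial (suc n) m j k + (t * lower a m (suc j)) * monomial (suc n) m (suc j) k ∎
        ... | no out = trans (*-vanishʳ t (*-vanishˡ _ a≈0))
                         (sym (trans (+-cong (*-vanishˡ _ (*-vanishʳ t (*-vanishʳ _ a≈0))) (*-vanishˡ _ (*-vanishʳ t (*-vanishʳ _ a≈0))))
                                     (+-identityʳ 0#)))
          where a≈0 = sup m j out

        NF-step : ∀ n t a → Supported n a →
                  (λ k → X (NF n a) k + t * Dq q (NF n a) k) ≐ NF (suc n) (next t a)
        NF-step n t a sup k = begin
          X (NF n a) k + t * Dq q (NF n a) k            ≈⟨ +-cong X-part D-part ⟩
          Σ² N′ N′ P₁ + (Σ² N′ N′ P₂ + Σ² N′ N′ P₃)     ≈⟨ +-congˡ (Σ²-+ N′ N′ P₂ P₃) ⟨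
          Σ² N′ N′ P₁ + Σ² N′ N′ (λ m j → P₂ m j + P₃ m j)  ≈⟨ Σ²-+ N′ N′ P₁ _ ⟨
          Σ² N′ N′ (λ m j → P₁ m j + (P₂ m j + P₃ m j))  ≈⟨ Σ²-cong N′ N′ (λ m j → solve 4 (λ r x y V → r :* V :+ (x :* V :+ y :* V) := (r :+ (x :+ y)) :* V) refl (raise a m j) _ _ (V m j)) ⟩
          NF (suc n) (next t a) k ∎
          where
            N = suc n
            N′ = suc N
            V : ℕ → ℕ → Carrier
            V m j = monomial (suc n) m j k
            P₁ P₂ P₃ : ℕ → ℕ → Carrier
            P₁ m j = raise a m j * V m j
            P₂ m j = (t * (q ^ (m ∸ j) * a m j)) * V m j
            P₃ m j = (t * lower a m j) * V m j
            P-vanish : ∀ u {x} w → x ≈ 0# → (t * (u * x)) * w ≈ 0#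
            P-vanish u w e = *-vanishˡ w (*-vanishʳ t (*-vanishʳ u e))
            P₃-lastRow : ∀ j → P₃ N j ≈ 0#
            P₃-lastRow zero    = *-vanishˡ _ (zeroʳ t)
            P₃-lastRow (suc j) = P-vanish _ _ (sup N j (¬inRange-row n j))
            -- The extra row and column of level n + 1 carry no diagonal or lowering terms.
            P₂-border : Σ² N′ N′ P₂ ≈ Σ² N N P₂
            P₂-border = trans (Σ²-dropLastRow N N′ P₂ (λ j → P-vanish _ _ (sup N j (¬inRange-row n j))))
                              (Σ²-dropLastCol N N P₂ (λ m → P-vanish _ _ (sup m N (¬inRange-col n m))))
            P₃-border : Σ² N′ N′ P₃ ≈ Σ² N N (λ m j → P₃ m (suc j))
            P₃-border = trans (Σ²-dropLastRow N N′ P₃ P₃-lastRow)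
                              (Σ²-dropFirstCol N N P₃ (λ m → *-vanishˡ _ (zeroʳ t)))
            X-part : X (NF n a) k ≈ Σ² N′ N′ P₁
            X-part = begin
              X (NF n a) k                                   ≈⟨ X-Σ² N N a (monomial n) k ⟩
              Σ² N N (λ m j → a m j * X (monomial n m j) k)  ≈⟨ Σ²-cong N N (X-monomial n a sup k) ⟩
              Σ² N N (λ m → P₁ (suc m))                      ≈⟨ Σ²-dropLastCol N N (λ m → P₁ (suc m)) (λ m → *-vanishˡ _ (sup m N (¬inRange-col n m))) ⟨
              Σ² N N′ (λ m → P₁ (suc m))                     ≈⟨ Σ²-dropFirstRow N N′ P₁ (λ j → zeroˡ _) ⟨
              Σ² N′ N′ P₁ ∎
            D-part : t * Dq q (NF n a) k ≈ Σ² N′ N′ P₂ + Σ² N′ N′ P₃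
            D-part = begin
              t * Dq q (NF n a) k                                        ≈⟨ *-congˡ (Dq-Σ² N N a (monomial n) k) ⟩
              t * Σ² N N (λ m j → a m j * Dq q (monomial n m j) k)       ≈⟨ Σ²-*ˡ N N t _ ⟩
              Σ² N N (λ m j → t * (a m j * Dq q (monomial n m j) k))     ≈⟨ Σ²-cong N N (Dq-monomial n t a sup k) ⟩
              Σ² N N (λ m j → P₂ m j + P₃ m (suc j))                     ≈⟨ Σ²-+ N N P₂ (λ m j → P₃ m (suc j)) ⟩
              Σ² N N P₂ + Σ² N N (λ m j → P₃ m (suc j))                  ≈⟨ +-cong P₂-border P₃-border ⟨
              Σ² N′ N′ P₂ + Σ² N′ N′ P₃ ∎

        NF-cong : ∀ n {a a′} → (∀ m j → a m j ≈ a′ m j) → NF n a ≐ NF n a′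
        NF-cong n e k = Σ²-cong (suc n) (suc n) (λ m j → *-congʳ (e m j))

  module ClosedForm (q s : Carrier) (q≉1 : ¬ q ≈ 1#)
                    (1+qⁱ≉0 : ∀ i → ¬ (1# + q ^ suc i) ≈ 0#)
                    (qint≉0 : ∀ i → ¬ qint q (suc i) ≈ 0#) where
    open QCalculus q
    open Derivative q≉1

    PP : ℕ → ℕ → Carrier
    PP a t = Π< t (λ i → 1# + q ^ (a ℕ.+ i))

    PP-shift : ∀ a t → (1# + q ^ (a ℕ.+ t)) * PP a t ≈ (1# + q ^ a) * PP (suc a) t
    PP-shift a zero = *-congʳ (+-congˡ (reflexive (P.cong (q ^_) (ℕₚ.+-identityʳ a))))
    PP-shift a (suc t) = begin
      (1# + q ^ (a ℕ.+ suc t)) * (PP a t * (1# + q ^ (a ℕ.+ t)))   ≈⟨ solve 3 (λ u P v → u :* (P :* v) := (v :* P) :* u) refl _ _ _ ⟩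
      ((1# + q ^ (a ℕ.+ t)) * PP a t) * (1# + q ^ (a ℕ.+ suc t))   ≈⟨ *-cong (PP-shift a t) (+-congˡ (reflexive (P.cong (q ^_) (ℕₚ.+-suc a t)))) ⟩
      ((1# + q ^ a) * PP (suc a) t) * (1# + q ^ (suc a ℕ.+ t))     ≈⟨ *-assoc _ _ _ ⟩
      (1# + q ^ a) * (PP (suc a) t * (1# + q ^ (suc a ℕ.+ t))) ∎

    PP-nonzero : ∀ t → ¬ PP 1 t ≈ 0#
    PP-nonzero zero    = λ e → 0≉1 (sym e)
    PP-nonzero (suc t) = *-nonzero (PP-nonzero t) (1+qⁱ≉0 t)

    qfact-nonzero : ∀ t → ¬ qfact q t ≈ 0#
    qfact-nonzero zero    = λ e → 0≉1 (sym e)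
    qfact-nonzero (suc t) = *-nonzero (qfact-nonzero t) (qint≉0 t)

    -- In the coordinates b = m - j, c = n - m - j the term (m, j) of the n-th
    -- normal form is K(j, b, c) X^b D_q^c with n = b + 2j + c and
    --   K(j, b, c) = numer / denom,
    --   numer = q^{C(j+1,2) + C(j+c,2)} (1 + q^{b+j+1}) ⋯ (1 + q^{b+j+c}) [n]! s^{j+c},
    --   denom = (1 + q) ⋯ (1 + q^{j+c}) [j]! [b]! [c]!.
    -- numer′ n is numer with the factorial [n]! made an explicit parameter.
    numer′ : ℕ → ℕ → ℕ → ℕ → Carrier
    numer′ n j b c = q ^ qexp j c * PP (suc (b ℕ.+ j)) c * (qfact q n * s ^ (j ℕ.+ c))

    numer denom K : ℕ → ℕ → ℕ → Carrier
    numer j b c = numer′ (b ℕ.+ j ℕ.+ (j ℕ.+ c)) j b c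
    denom j b c = PP 1 (j ℕ.+ c) * qfact q j * qfact q b * qfact q c
    K j b c = numer j b c * denom j b c ⁻¹

    denom-nonzero : ∀ j b c → ¬ denom j b c ≈ 0#
    denom-nonzero j b c =
      *-nonzero (*-nonzero (*-nonzero (PP-nonzero (j ℕ.+ c)) (qfact-nonzero j)) (qfact-nonzero b)) (qfact-nonzero c)

    K-denom : ∀ j b c → K j b c * denom j b c ≈ numer j b c
    K-denom j b c = ⁻¹-cancelʳ (numer j b c) (denom-nonzero j b c)

    coeff≡K : ∀ {n m} j b c → m ≡ b ℕ.+ j → n ≡ b ℕ.+ j ℕ.+ (j ℕ.+ c) → coeff q s n m j ≡ K j b c
    coeff≡K j b c P.refl P.refl = cong₄ shape
      (ℕₚ.m+n∸m≡n (b ℕ.+ j) (j ℕ.+ c))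
      (P.trans (ℕₚ.∸-+-assoc (b ℕ.+ j ℕ.+ (j ℕ.+ c)) j (b ℕ.+ j))
        (P.trans (P.cong (_∸ (j ℕ.+ (b ℕ.+ j))) (reorder b j c)) (ℕₚ.m+n∸m≡n (j ℕ.+ (b ℕ.+ j)) c)))
      (ℕₚ.m+n∸n≡m b j)
      (P.trans (P.cong (_∸ j) (ℕₚ.m+n∸m≡n (b ℕ.+ j) (j ℕ.+ c))) (ℕₚ.m+n∸m≡n j c))
      where
        shape : ℕ → ℕ → ℕ → ℕ → Carrier
        shape d e b′ c′ = q ^ (suc j C 2 ℕ.+ d C 2) * PP (suc (b ℕ.+ j)) e
                          * (qfact q (b ℕ.+ j ℕ.+ (j ℕ.+ c)) * s ^ d)
                          * ((PP 1 d * qfact q j * qfact q b′ * qfact q c′) ⁻¹)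
        cong₄ : ∀ (h : ℕ → ℕ → ℕ → ℕ → Carrier) {d d′ e e′ b′ b″ c′ c″} →
                d ≡ d′ → e ≡ e′ → b′ ≡ b″ → c′ ≡ c″ → h d e b′ c′ ≡ h d′ e′ b″ c″
        cong₄ h P.refl P.refl P.refl P.refl = P.refl
        reorder : ∀ b j c → b ℕ.+ j ℕ.+ (j ℕ.+ c) ≡ (j ℕ.+ (b ℕ.+ j)) ℕ.+ c
        reorder = solve-∀

    -- The three contributions to K(j, b, c) from the previous level n = b + 2j + c - 1
    -- (raising X, the diagonal part of D_q, and the lowering part of D_q).
    t₁ t₂ t₃ : ℕ → ℕ → ℕ → Carrier
    t₁ j zero    c = 0#
    t₁ j (suc b) c = K j b c
    t₂ j b zero    = 0#
    t₂ j b (suc c) = (q ^ (b ℕ.+ j ℕ.+ (j ℕ.+ c)) * s) * (q ^ b * K j b c)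
    t₃ zero    b c = 0#
    t₃ (suc j) b c = (q ^ (suc b ℕ.+ j ℕ.+ (j ℕ.+ c)) * s) * (qint q (suc b) * K j (suc b) c)

    -- The common factor 1 + q^{b+j+c} of the recurrence after clearing denominators.
    W : ℕ → ℕ → ℕ → Carrier
    W j b c = 1# + q ^ j * q ^ b * q ^ c

    W-nonzero : ∀ n j b c → suc n ≡ b ℕ.+ j ℕ.+ (j ℕ.+ c) → ¬ W j b c ≈ 0#
    W-nonzero n j b c eq W≈0 with b ℕ.+ j ℕ.+ c in b+j+c≡
    ... | zero = ℕₚ.0≢1+n (P.sym (P.trans eq (vanish b j c b+j+c≡)))
      where
        vanish : ∀ b j c → b ℕ.+ j ℕ.+ c ≡ 0 → b ℕ.+ j ℕ.+ (j ℕ.+ c) ≡ 0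
        vanish zero zero zero _ = P.refl
    ... | suc i = 1+qⁱ≉0 i (begin
      1# + q ^ suc i               ≡⟨ P.cong (λ u → 1# + q ^ u) (P.sym b+j+c≡) ⟩
      1# + q ^ (b ℕ.+ j ℕ.+ c)     ≈⟨ +-congˡ (^-+₃ q b j c) ⟩
      1# + q ^ b * q ^ j * q ^ c   ≈⟨ +-congˡ (*-congʳ (*-comm _ _)) ⟩
      W j b c                      ≈⟨ W≈0 ⟩
      0# ∎)

    numer-split : ∀ n j b c → suc n ≡ b ℕ.+ j ℕ.+ (j ℕ.+ c) → numer j b c ≈ numer′ n j b c * qint q (suc n)
    numer-split n j b c eq = begin
      numer j b c          ≡⟨ P.cong (λ u → numer′ u j b c) (P.sym eq) ⟩
      numer′ (suc n) j b c ≈⟨ solve 5 (λ E P F I S → E :* P :* ((F :* I) :* S) := (E :* P :* (F :* S)) :* I) refl (q ^ qexp j c) (PP (suc (b ℕ.+ j)) c) (qfact q n) (qint q (suc n)) (s ^ (j ℕ.+ c)) ⟩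
      numer′ n j b c * qint q (suc n) ∎

    denom-sucᶜ : ∀ j b c → denom j b (suc c) ≈ denom j b c * ((1# + q ^ suc (j ℕ.+ c)) * qint q (suc c))
    denom-sucᶜ j b c = begin
      PP 1 (j ℕ.+ suc c) * Qj * Qb * (Qc * C′)                 ≡⟨ P.cong (λ u → PP 1 u * Qj * Qb * (Qc * C′)) (ℕₚ.+-suc j c) ⟩
      (PP 1 (j ℕ.+ c) * Z) * Qj * Qb * (Qc * C′)               ≈⟨ solve 6 (λ P Z Qj Qb Qc C′ → (P :* Z) :* Qj :* Qb :* (Qc :* C′) := P :* Qj :* Qb :* Qc :* (Z :* C′)) refl (PP 1 (j ℕ.+ c)) Z Qj Qb Qc C′ ⟩
      denom j b c * (Z * C′) ∎
      where
        Qj = qfact q j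
        Qb = qfact q b
        Qc = qfact q c
        C′ = qint q (suc c)
        Z = 1# + q ^ suc (j ℕ.+ c)

    denom-sucʲ : ∀ j b c → denom (suc j) b c * qint q (suc b) ≈ denom j (suc b) c * ((1# + q ^ suc (j ℕ.+ c)) * qint q (suc j))
    denom-sucʲ j b c = solve 7 (λ P Z Qj A Qb B Qc →
        (P :* Z) :* (Qj :* A) :* Qb :* Qc :* B := P :* Qj :* (Qb :* B) :* Qc :* (Z :* A))
      refl (PP 1 (j ℕ.+ c)) (1# + q ^ suc (j ℕ.+ c)) (qfact q j) (qint q (suc j)) (qfact q b) (qint q (suc b)) (qfact q c)

    -- After multiplying by W · denom, each contribution becomes numer′ n times a
    -- polynomial in A = [j], B = [b], C = [c], x = q^j, y = q^b, z = q^c; these are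
    -- the three summands of recurrence-identity.
    from-raise : ∀ n j b c → suc n ≡ b ℕ.+ j ℕ.+ (j ℕ.+ c) →
      W j b c * (t₁ j b c * denom j b c) ≈ numer′ n j b c * (qint q b * (1# + q ^ j * q ^ b))
    from-raise n j zero c _ = trans (*-vanishʳ _ (zeroˡ _)) (sym (*-vanishʳ _ (zeroˡ _)))
    from-raise n j (suc b) c eq = begin
      W′ * (K j b c * denom j (suc b) c)                 ≈⟨ *-congˡ (solve 6 (λ K P Qj Qb B Qc → K :* (P :* Qj :* (Qb :* B) :* Qc) := (K :* (P :* Qj :* Qb :* Qc)) :* B) refl (K j b c) (PP 1 (j ℕ.+ c)) (qfact q j) (qfact q b) B (qfact q c)) ⟩
      W′ * ((K j b c * denom j b c) * B)                 ≈⟨ *-congˡ (*-congʳ (K-denom j b c)) ⟩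
      W′ * (numer j b c * B)                             ≡⟨ P.cong (λ u → W′ * (numer′ u j b c * B)) (P.sym (ℕₚ.suc-injective eq)) ⟩
      W′ * (E * Pc * (Fn * S) * B)                       ≈⟨ solve 6 (λ W E P F S B → W :* (E :* P :* (F :* S) :* B) := E :* (W :* P) :* (F :* S) :* B) refl W′ E Pc Fn S B ⟩
      E * (W′ * Pc) * (Fn * S) * B                       ≈⟨ *-congʳ (*-congʳ (*-congˡ W′Pc)) ⟩
      E * ((1# + q ^ suc b * q ^ j) * Pc′) * (Fn * S) * B ≈⟨ solve 7 (λ E x y P F S B → E :* ((con 1 :+ y :* x) :* P) :* (F :* S) :* B := E :* P :* (F :* S) :* (B :* (con 1 :+ x :* y))) refl E (q ^ j) (q ^ suc b) Pc′ Fn S B ⟩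
      numer′ n j (suc b) c * (B * (1# + q ^ j * q ^ suc b)) ∎
      where
        W′ = W j (suc b) c
        E = q ^ qexp j c
        Pc = PP (suc (b ℕ.+ j)) c
        Pc′ = PP (suc (suc b ℕ.+ j)) c
        Fn = qfact q n
        S = s ^ (j ℕ.+ c)
        B = qint q (suc b)
        W′Pc : W′ * Pc ≈ (1# + q ^ suc b * q ^ j) * Pc′
        W′Pc = begin
          W′ * Pc                                          ≈⟨ *-congʳ (+-congˡ (solve 3 (λ x y z → x :* y :* z := y :* x :* z) refl (q ^ j) (q ^ suc b) (q ^ c))) ⟩
          (1# + q ^ suc b * q ^ j * q ^ c) * Pc            ≈⟨ *-congʳ (+-congˡ (^-+₃ q (suc b) j c)) ⟨
          (1# + q ^ (suc (b ℕ.+ j) ℕ.+ c)) * Pc            ≈⟨ PP-shift (suc (b ℕ.+ j)) c ⟩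
          (1# + q ^ suc (b ℕ.+ j)) * Pc′                   ≈⟨ *-congʳ (+-congˡ (^-+ q (suc b) j)) ⟩
          (1# + q ^ suc b * q ^ j) * Pc′ ∎

    from-diag : ∀ n j b c → suc n ≡ b ℕ.+ j ℕ.+ (j ℕ.+ c) →
      W j b c * (t₂ j b c * denom j b c) ≈ numer′ n j b c * (q ^ j * q ^ b * q ^ b * qint q c * (1# + q ^ j * q ^ c))
    from-diag n j b zero _ = trans (*-vanishʳ _ (zeroˡ _)) (sym (*-vanishʳ _ (*-vanishˡ _ (zeroʳ _))))
    from-diag n j b (suc c) eq = begin
      W′ * ((qn * s) * (y * K j b c) * denom j b (suc c))       ≈⟨ *-congˡ (*-congˡ (denom-sucᶜ j b c)) ⟩
      W′ * ((qn * s) * (y * K j b c) * (denom j b c * (Z * C′))) ≈⟨ solve 8 (λ W Q s y K D Z C′ → W :* ((Q :* s) :* (y :* K) :* (D :* (Z :* C′))) := (Q :* s :* y) :* (K :* D) :* (W :* Z :* C′)) refl W′ qn s y (K j b c) (denom j b c) Z C′ ⟩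
      (qn * s * y) * (K j b c * denom j b c) * (W′ * Z * C′)     ≈⟨ *-congʳ (*-congˡ (K-denom j b c)) ⟩
      (qn * s * y) * (E * Pc * (Fn′ * S)) * (W′ * Z * C′)        ≈⟨ solve 10 (λ Q s y E P F S W Z C′ → (Q :* s :* y) :* (E :* P :* (F :* S)) :* (W :* Z :* C′) := (Q :* E) :* (W :* P) :* F :* (s :* S) :* y :* Z :* C′) refl qn s y E Pc Fn′ S W′ Z C′ ⟩
      (qn * E) * (W′ * Pc) * Fn′ * (s * S) * y * Z * C′
        ≈⟨ *-congʳ (*-cong (*-congʳ (*-cong (*-cong (*-congʳ exponent) factorial) power)) Z≈) ⟩
      (E′ * x * y) * (W′ * Pc) * qfact q n * s ^ (j ℕ.+ suc c) * y * (1# + x * z) * C′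
        ≈⟨ *-congʳ (*-congʳ (*-congʳ (*-congʳ (*-congʳ (*-congˡ W′Pc))))) ⟩
      (E′ * x * y) * Pc′ * qfact q n * s ^ (j ℕ.+ suc c) * y * (1# + x * z) * C′
        ≈⟨ solve 8 (λ E x y P F S z C′ → (E :* x :* y) :* P :* F :* S :* y :* (con 1 :+ x :* z) :* C′ := E :* P :* (F :* S) :* (x :* y :* y :* C′ :* (con 1 :+ x :* z))) refl E′ x y Pc′ (qfact q n) (s ^ (j ℕ.+ suc c)) z C′ ⟩
      numer′ n j b (suc c) * (x * y * y * C′ * (1# + x * z)) ∎
      where
        x = q ^ j
        y = q ^ b
        z = q ^ suc c
        W′ = W j b (suc c)
        n′ = b ℕ.+ j ℕ.+ (j ℕ.+ c)
        qn = q ^ n′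
        E = q ^ qexp j c
        E′ = q ^ qexp j (suc c)
        Pc = PP (suc (b ℕ.+ j)) c
        Pc′ = PP (suc (b ℕ.+ j)) (suc c)
        Fn′ = qfact q n′
        S = s ^ (j ℕ.+ c)
        C′ = qint q (suc c)
        Z = 1# + q ^ suc (j ℕ.+ c)
        n≡n′ : n ≡ n′
        n≡n′ = ℕₚ.suc-injective (P.trans eq (P.trans (P.cong (b ℕ.+ j ℕ.+_) (ℕₚ.+-suc j c)) (ℕₚ.+-suc (b ℕ.+ j) (j ℕ.+ c))))
        exponent : qn * E ≈ E′ * x * y
        exponent = begin
          qn * E                        ≈⟨ ^-+ q n′ (qexp j c) ⟨
          q ^ (n′ ℕ.+ qexp j c)         ≡⟨ P.cong (q ^_) (qexp-sucᶜ b j c) ⟩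
          q ^ (qexp j (suc c) ℕ.+ j ℕ.+ b) ≈⟨ ^-+₃ q (qexp j (suc c)) j b ⟩
          E′ * x * y ∎
        factorial : Fn′ ≈ qfact q n
        factorial = reflexive (P.cong (qfact q) (P.sym n≡n′))
        power : s * S ≈ s ^ (j ℕ.+ suc c)
        power = reflexive (P.cong (s ^_) (P.sym (ℕₚ.+-suc j c)))
        Z≈ : Z ≈ 1# + x * z
        Z≈ = +-congˡ (trans (reflexive (P.cong (q ^_) (P.sym (ℕₚ.+-suc j c)))) (^-+ q j (suc c)))
        W′Pc : W′ * Pc ≈ Pc′
        W′Pc = begin
          W′ * Pc                                ≈⟨ *-comm W′ Pc ⟩
          Pc * (1# + x * y * z)                  ≈⟨ *-congˡ (+-congˡ (solve 3 (λ x y z → x :* y :* z := y :* x :* z) refl x y z)) ⟩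
          Pc * (1# + y * x * z)                  ≈⟨ *-congˡ (+-congˡ (^-+₃ q b j (suc c))) ⟨
          Pc * (1# + q ^ (b ℕ.+ j ℕ.+ suc c))    ≡⟨ P.cong (λ u → Pc * (1# + q ^ u)) (ℕₚ.+-suc (b ℕ.+ j) c) ⟩
          Pc′ ∎

    from-lower : ∀ n j b c → suc n ≡ b ℕ.+ j ℕ.+ (j ℕ.+ c) →
      W j b c * (t₃ j b c * denom j b c) ≈ numer′ n j b c * (q ^ b * qint q j * (1# + q ^ j * q ^ c) * W j b c)
    from-lower n zero b c _ = trans (*-vanishʳ _ (zeroˡ _)) (sym (*-vanishʳ _ (*-vanishˡ _ (*-vanishˡ _ (zeroʳ _)))))
    from-lower n (suc j) b c eq = begin
      W′ * ((qn * s) * (B * K′) * denom (suc j) b c)      ≈⟨ solve 6 (λ W Q s B K D → W :* ((Q :* s) :* (B :* K) :* D) := (Q :* s) :* (K :* (D :* B)) :* W) refl W′ qn s B K′ (denom (suc j) b c) ⟩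
      (qn * s) * (K′ * (denom (suc j) b c * B)) * W′      ≈⟨ *-congʳ (*-congˡ (*-congˡ (denom-sucʲ j b c))) ⟩
      (qn * s) * (K′ * (denom j (suc b) c * (Z * A))) * W′ ≈⟨ solve 7 (λ Q s K D Z A W → (Q :* s) :* (K :* (D :* (Z :* A))) :* W := (Q :* s) :* (K :* D) :* Z :* A :* W) refl qn s K′ (denom j (suc b) c) Z A W′ ⟩
      (qn * s) * (K′ * denom j (suc b) c) * Z * A * W′    ≈⟨ *-congʳ (*-congʳ (*-congʳ (*-congˡ (K-denom j (suc b) c)))) ⟩
      (qn * s) * (E * Pc * (Fn′ * S)) * Z * A * W′        ≈⟨ solve 9 (λ Q s E P F S Z A W → (Q :* s) :* (E :* P :* (F :* S)) :* Z :* A :* W := (Q :* E) :* P :* F :* (s :* S) :* Z :* A :* W) refl qn s E Pc Fn′ S Z A W′ ⟩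
      (qn * E) * Pc * Fn′ * (s * S) * Z * A * W′          ≈⟨ *-congʳ (*-congʳ (*-cong (*-cong (*-cong (*-cong exponent Pc≈) factorial) refl) Z≈)) ⟩
      (E′ * y) * Pc′ * qfact q n * (s * S) * (1# + x * z) * A * W′
        ≈⟨ solve 8 (λ E y P F S xz A W → (E :* y) :* P :* F :* S :* (con 1 :+ xz) :* A :* W := E :* P :* (F :* S) :* (y :* A :* (con 1 :+ xz) :* W)) refl E′ y Pc′ (qfact q n) (s * S) (x * z) A W′ ⟩
      numer′ n (suc j) b c * (y * A * (1# + x * z) * W′) ∎
      where
        x = q ^ suc j
        y = q ^ b
        z = q ^ c
        W′ = W (suc j) b c
        n′ = suc b ℕ.+ j ℕ.+ (j ℕ.+ c)
        qn = q ^ n′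
        B = qint q (suc b)
        A = qint q (suc j)
        K′ = K j (suc b) c
        E = q ^ qexp j c
        E′ = q ^ qexp (suc j) c
        Pc = PP (suc (suc b ℕ.+ j)) c
        Pc′ = PP (suc (b ℕ.+ suc j)) c
        Fn′ = qfact q n′
        S = s ^ (j ℕ.+ c)
        Z = 1# + q ^ suc (j ℕ.+ c)
        n≡n′ : n ≡ n′
        n≡n′ = ℕₚ.suc-injective (P.trans eq (P.trans (P.cong (ℕ._+ suc (j ℕ.+ c)) (ℕₚ.+-suc b j)) (ℕₚ.+-suc (suc (b ℕ.+ j)) (j ℕ.+ c))))
        exponent : qn * E ≈ E′ * y
        exponent = begin
          qn * E                      ≈⟨ ^-+ q n′ (qexp j c) ⟨
          q ^ (n′ ℕ.+ qexp j c)       ≡⟨ P.cong (q ^_) (qexp-sucʲ b j c) ⟩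
          q ^ (qexp (suc j) c ℕ.+ b)  ≈⟨ ^-+ q (qexp (suc j) c) b ⟩
          E′ * y ∎
        Pc≈ : Pc ≈ Pc′
        Pc≈ = reflexive (P.cong (λ u → PP (suc u) c) (P.sym (ℕₚ.+-suc b j)))
        factorial : Fn′ ≈ qfact q n
        factorial = reflexive (P.cong (qfact q) (P.sym n≡n′))
        Z≈ : Z ≈ 1# + x * z
        Z≈ = +-congˡ (^-+ q (suc j) c)

    qint-split : ∀ n j b c → suc n ≡ b ℕ.+ j ℕ.+ (j ℕ.+ c) →
      qint q (suc n) ≈ qint q b + q ^ b * qint q j + q ^ b * q ^ j * (qint q j + q ^ j * qint q c)
    qint-split n j b c eq = begin
      qint q (suc n)                                              ≡⟨ P.cong (qint q) eq ⟩
      qint q (b ℕ.+ j ℕ.+ (j ℕ.+ c))                              ≈⟨ qint-+ (b ℕ.+ j) (j ℕ.+ c) ⟩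
      qint q (b ℕ.+ j) + q ^ (b ℕ.+ j) * qint q (j ℕ.+ c)         ≈⟨ +-cong (qint-+ b j) (*-cong (^-+ q b j) (qint-+ j c)) ⟩
      qint q b + q ^ b * qint q j + q ^ b * q ^ j * (qint q j + q ^ j * qint q c) ∎

    -- The closed form satisfies the recurrence K = t₁ + t₂ + t₃ for n + 1 = b + 2j + c:
    -- multiply by W · denom and apply recurrence-identity.
    K-recurrence : ∀ n j b c → suc n ≡ b ℕ.+ j ℕ.+ (j ℕ.+ c) → K j b c ≈ t₁ j b c + (t₂ j b c + t₃ j b c)
    K-recurrence n j b c eq = sym (*-cancelʳ (denom-nonzero j b c) (*-cancelˡ (W-nonzero n j b c eq) (begin
      Wᵢ * (T * D)                                             ≈⟨ solve 5 (λ W a b c D → W :* ((a :+ (b :+ c)) :* D) := W :* (a :* D) :+ (W :* (b :* D) :+ W :* (c :* D))) refl Wᵢ (t₁ j b c) (t₂ j b c) (t₃ j b c) D ⟩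
      Wᵢ * (t₁ j b c * D) + (Wᵢ * (t₂ j b c * D) + Wᵢ * (t₃ j b c * D))
                                                               ≈⟨ +-cong (from-raise n j b c eq) (+-cong (from-diag n j b c eq) (from-lower n j b c eq)) ⟩
      G * ρ₁ + (G * ρ₂ + G * ρ₃)                               ≈⟨ solve 4 (λ G a b c → G :* a :+ (G :* b :+ G :* c) := G :* (a :+ (b :+ c))) refl G ρ₁ ρ₂ ρ₃ ⟩
      G * (ρ₁ + (ρ₂ + ρ₃))                                     ≈⟨ *-congˡ (recurrence-identity A B C′ x y z (qint-suc j) (qint-suc b) (qint-suc c)) ⟨
      G * ((B + y * A + y * x * (A + x * C′)) * Wᵢ)             ≈⟨ *-congˡ (*-congʳ (qint-split n j b c eq)) ⟨
      G * (qint q (suc n) * Wᵢ)                                 ≈⟨ solve 3 (λ G I W → G :* (I :* W) := W :* (G :* I)) refl G (qint q (suc n)) Wᵢ ⟩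
      Wᵢ * (G * qint q (suc n))                                 ≈⟨ *-congˡ (numer-split n j b c eq) ⟨
      Wᵢ * numer j b c                                         ≈⟨ *-congˡ (K-denom j b c) ⟨
      Wᵢ * (K j b c * D) ∎)))
      where
        x = q ^ j
        y = q ^ b
        z = q ^ c
        A = qint q j
        B = qint q b
        C′ = qint q c
        Wᵢ = W j b c
        D = denom j b c
        T = t₁ j b c + (t₂ j b c + t₃ j b c)
        G = numer′ n j b c
        ρ₁ = B * (1# + x * y)
        ρ₂ = x * y * y * C′ * (1# + x * z)
        ρ₃ = y * A * (1# + x * z) * Wᵢ

    closed : ℕ → Coeffs
    closed n m j = when (inRange? n m j) (coeff q s n m j)

    closed-supported : ∀ n → Supported n (closed n)
    closed-supported n m j out = when-no (inRange? n m j) out _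

    inRange-coords : ∀ {n m} j b c → m ≡ b ℕ.+ j → n ≡ b ℕ.+ j ℕ.+ (j ℕ.+ c) → InRange n m j
    inRange-coords j b c P.refl P.refl = ℕₚ.m≤n+m j b , ℕₚ.+-monoʳ-≤ (b ℕ.+ j) (ℕₚ.m≤m+n j c)

    raise-closed : ∀ n m j b c → m ≡ b ℕ.+ j → suc n ≡ b ℕ.+ j ℕ.+ (j ℕ.+ c) → raise (closed n) m j ≈ t₁ j b c
    raise-closed n zero    j zero    c _  _  = refl
    raise-closed n zero    j (suc b) c () _
    raise-closed n (suc m) j zero    c hm _  =
      when-no (inRange? n m j) (λ (j≤m , _) → ℕₚ.1+n≰n (P.subst (_≤ m) (P.sym hm) j≤m)) _
    raise-closed n (suc m) j (suc b) c hm eq = trans (when-yes (inRange? n m j) (inRange-coords j b c m≡ n≡) _) (reflexive (coeff≡K j b c m≡ n≡))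
      where
        m≡ = ℕₚ.suc-injective hm
        n≡ = ℕₚ.suc-injective eq

    diag-closed : ∀ n m j b c → m ≡ b ℕ.+ j → suc n ≡ b ℕ.+ j ℕ.+ (j ℕ.+ c) →
                  (q ^ n * s) * (q ^ (m ∸ j) * closed n m j) ≈ t₂ j b c
    diag-closed n m j b zero hm eq = *-vanishʳ _ (*-vanishʳ _ (when-no (inRange? n m j) (λ (_ , m+j≤n) → ℕₚ.1+n≰n (P.subst (_≤ n) m+j≡ m+j≤n)) _))
      where
        m+j≡ : m ℕ.+ j ≡ suc n
        m+j≡ = P.trans (P.cong (ℕ._+ j) hm) (P.trans (P.cong (b ℕ.+ j ℕ.+_) (P.sym (ℕₚ.+-identityʳ j))) (P.sym eq))
    diag-closed n m j b (suc c) hm eq = trans (*-congˡ (*-congˡ (when-yes (inRange? n m j) (inRange-coords j b c hm n≡) _)))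
      (reflexive (P.cong₂ (λ u v → (q ^ u * s) * v) n≡
             (P.cong₂ _*_ (P.cong (q ^_) (P.trans (P.cong (_∸ j) hm) (ℕₚ.m+n∸n≡m b j))) (coeff≡K j b c hm n≡))))
      where
        n≡ = ℕₚ.suc-injective (P.trans eq (P.trans (P.cong (b ℕ.+ j ℕ.+_) (ℕₚ.+-suc j c)) (ℕₚ.+-suc (b ℕ.+ j) (j ℕ.+ c))))

    lower-closed : ∀ n m j b c → m ≡ b ℕ.+ j → suc n ≡ b ℕ.+ j ℕ.+ (j ℕ.+ c) →
                   (q ^ n * s) * lower (closed n) m j ≈ t₃ j b c
    lower-closed n m zero b c _ _ = zeroʳ _
    lower-closed n m (suc j) b c hm eq = trans (*-congˡ (*-congˡ (when-yes (inRange? n m j) (inRange-coords j (suc b) c m≡ n≡) _)))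
      (reflexive (P.cong₂ (λ u v → (q ^ u * s) * v) n≡
             (P.cong₂ _*_ (P.cong (qint q) (P.trans (P.cong (_∸ j) m≡) (ℕₚ.m+n∸n≡m (suc b) j))) (coeff≡K j (suc b) c m≡ n≡))))
      where
        m≡ = P.trans hm (ℕₚ.+-suc b j)
        n≡ = ℕₚ.suc-injective (P.trans eq (P.trans (P.cong (ℕ._+ suc (j ℕ.+ c)) (ℕₚ.+-suc b j)) (ℕₚ.+-suc (suc (b ℕ.+ j)) (j ℕ.+ c))))

    closed-recurrence : ∀ n m j → closed (suc n) m j ≈ next (q ^ n * s) (closed n) m j
    closed-recurrence n m j with inRange? (suc n) m j
    ... | no out = sym (next-supported n (q ^ n * s) (closed n) (closed-supported n) m j out)
    ... | yes (j≤m , m+j≤sn) = begin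
      coeff q s (suc n) m j            ≡⟨ coeff≡K j b c hm eq ⟩
      K j b c                          ≈⟨ K-recurrence n j b c eq ⟩
      t₁ j b c + (t₂ j b c + t₃ j b c) ≈⟨ +-cong (raise-closed n m j b c hm eq) (+-cong (diag-closed n m j b c hm eq) (lower-closed n m j b c hm eq)) ⟨
      next (q ^ n * s) (closed n) m j ∎
      where
        b = m ∸ j
        c = suc n ∸ (m ℕ.+ j)
        hm : m ≡ b ℕ.+ j
        hm = P.sym (ℕₚ.m∸n+n≡m j≤m)
        eq : suc n ≡ b ℕ.+ j ℕ.+ (j ℕ.+ c)
        eq = P.trans (P.sym (ℕₚ.m+[n∸m]≡n m+j≤sn)) (P.trans (P.cong (λ u → u ℕ.+ j ℕ.+ c) hm) (ℕₚ.+-assoc (b ℕ.+ j) j c))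

    coeff-base : coeff q s 0 0 0 ≈ 1#
    coeff-base = trans (reflexive (coeff≡K 0 0 0 P.refl P.refl))
      (*-cancelʳ (denom-nonzero 0 0 0) (trans (K-denom 0 0 0) (solve 0 (con 1 :* con 1 :* (con 1 :* con 1) := con 1 :* (con 1 :* con 1 :* con 1 :* con 1)) refl)))

    module _ (f : Poly) where
      open NormalForm f

      lhs-NF : ∀ n → lhs q s n f ≐ NF n (closed n)
      lhs-NF zero k = begin
        f k                                      ≈⟨ *-identityˡ (f k) ⟨
        1# * f k                                 ≈⟨ *-congʳ coeff-base ⟨
        coeff q s 0 0 0 * f k                    ≈⟨ trans (+-identityˡ _) (+-identityˡ _) ⟨
        0# + (0# + coeff q s 0 0 0 * f k) ∎
      lhs-NF (suc n) k = begin
        X (lhs q s n f) k + (q ^ n * s) * Dq q (lhs q s n f) k                ≈⟨ +-cong (X-cong (lhs-NF n) k) (*-congˡ (Dq-cong (lhs-NF n) k)) ⟩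
        X (NF n (closed n)) k + (q ^ n * s) * Dq q (NF n (closed n)) k        ≈⟨ NF-step n (q ^ n * s) (closed n) (closed-supported n) k ⟩
        NF (suc n) (next (q ^ n * s) (closed n)) k                           ≈⟨ NF-cong (suc n) (closed-recurrence n) k ⟨
        NF (suc n) (closed (suc n)) k ∎

      rhs-NF : ∀ n → rhs q s n f ≐ NF n (closed n)
      rhs-NF n k = Σ-cong< (suc n) (λ m m<1+n → row m (ℕₚ.≤-pred m<1+n))
        where
          row : ∀ m → m ≤ n → Σ< (suc (m ⊓ (n ∸ m))) (λ j → coeff q s n m j * monomial n m j k) ≈
                              Σ< (suc n) (λ j → closed n m j * monomial n m j k)
          row m m≤n = sym (begin
            Σ< (suc n) (λ j → closed n m j * V j)      ≈⟨ Σ-pad _ (s≤s p≤n) (λ j p<j → *-vanishˡ _ (closed-supported n m j (λ r → ℕₚ.<⇒≱ p<j (≤p r)))) ⟩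
            Σ< (suc p) (λ j → closed n m j * V j)      ≈⟨ Σ-cong< (suc p) (λ j j<1+p → *-congʳ (when-yes (inRange? n m j) (inRange-of (ℕₚ.≤-pred j<1+p)) _)) ⟩
            Σ< (suc p) (λ j → coeff q s n m j * V j) ∎)
            where
              p = m ⊓ (n ∸ m)
              V : ℕ → Carrier
              V j = monomial n m j k
              p≤n : p ≤ n
              p≤n = ℕₚ.≤-trans (ℕₚ.m⊓n≤m m (n ∸ m)) m≤n
              ≤p : ∀ {j} → InRange n m j → j ≤ p
              ≤p {j} (j≤m , m+j≤n) = ℕₚ.⊓-glb j≤m (ℕₚ.m+n≤o⇒m≤o∸n j (P.subst (_≤ n) (ℕₚ.+-comm m j) m+j≤n))
              inRange-of : ∀ {j} → j ≤ p → InRange n m j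
              inRange-of {j} j≤p = ℕₚ.m≤n⊓o⇒m≤n m (n ∸ m) j≤p ,
                P.subst (m ℕ.+ j ≤_) (ℕₚ.m+[n∸m]≡n m≤n) (ℕₚ.+-monoʳ-≤ m (ℕₚ.m≤n⊓o⇒m≤o m (n ∸ m) j≤p))

      lhs≈rhs : ∀ n → lhs q s n f ≐ rhs q s n f
      lhs≈rhs n k = trans (lhs-NF n k) (sym (rhs-NF n k))

corollary2 : {c ℓ : Level} (F : Field c ℓ) →
    let open Field F in let open Ops F in
    (q s : Carrier) →
    ¬ (q ≈ 1#) →
    (∀ i → ¬ ((1# + q ^ suc i) ≈ 0#)) →
    (∀ i → ¬ (qint q (suc i) ≈ 0#)) →
    (n : ℕ) (f : Poly) → FiniteSupport f →
    ∀ k → lhs q s n f k ≈ rhs q s n f k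
corollary2 F q s q≉1 1+qⁱ≉0 qint≉0 n f _ = ClosedForm.lhs≈rhs F q s q≉1 1+qⁱ≉0 qint≉0 f n
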